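{- The positive integer solutions $(x,y)$ of \[x^2+y^2+2x+2y+x^2y+xy^2+1=9xy\] are exactly $(1,1),(1,2),(2,1),(2,3),(3,2)$. -}

module Defs where

{-# OPTIONS --safe #-}
module Submission where

open import Defs
open import Data.Nat using (ℕ; _+_; _*_; _≤_; _<_; _≟_; _≤?_; s≤s; z≤n)
open import Data.Nat.Properties
  using (≤-trans; ≤-<-trans; m≤m+n; <-irrefl; m≤n+m; m<m+n; *-monoˡ-≤; ≰⇒>; allUpTo?)
open import Data.Nat.Tactic.RingSolver using (solve-∀)
open import Data.Product using (_×_; _,_)
open import Data.Sum using (_⊎_; inj₁; inj₂)
open import Relation.Binary.PropositionalEquality using (_≡_; refl; sym; module ≡-Reasoning)
open ≡-Reasoning
open import Relation.Nullary.Decidable using (Dec; yes; no; _×-dec_; _⊎-dec_; _→-dec_; from-yes)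
open import Relation.Nullary.Negation using (contradiction)
open import Function.Bundles using (_⇔_; mk⇔)

-- The left-hand side exceeds its cubic term x²y, so a solution with x ≥ 9 would
-- give 9xy ≤ x²y < 9xy; by symmetry also y < 9, and the remaining 81 candidates
-- are checked by evaluation.

lhs : ℕ → ℕ → ℕ
lhs x y = x * x + y * y + 2 * x + 2 * y + x * x * y + x * y * y + 1

Solution : ℕ → ℕ → Set
Solution x y = lhs x y ≡ 9 * x * y

Listed : ℕ → ℕ → Set
Listed x y = (x ≡ 1 × y ≡ 1) ⊎ (x ≡ 1 × y ≡ 2) ⊎ (x ≡ 2 × y ≡ 1) ⊎ (x ≡ 2 × y ≡ 3) ⊎ (x ≡ 3 × y ≡ 2)

solution? : ∀ x y → Dec (Solution x y)
solution? x y = lhs x y ≟ 9 * x * y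

listed? : ∀ x y → Dec (Listed x y)
listed? x y = (x ≟ 1 ×-dec y ≟ 1) ⊎-dec (x ≟ 1 ×-dec y ≟ 2) ⊎-dec (x ≟ 2 ×-dec y ≟ 1)
  ⊎-dec (x ≟ 2 ×-dec y ≟ 3) ⊎-dec (x ≟ 3 ×-dec y ≟ 2)

lhs-comm : ∀ x y → lhs x y ≡ lhs y x
lhs-comm = expanded
  where
  expanded : ∀ x y → x * x + y * y + 2 * x + 2 * y + x * x * y + x * y * y + 1
                   ≡ y * y + x * x + 2 * y + 2 * x + y * y * x + y * x * x + 1
  expanded = solve-∀

solution-sym : ∀ x y → Solution x y → Solution y x
solution-sym x y eq = begin
  lhs y x    ≡⟨ lhs-comm y x ⟩
  lhs x y    ≡⟨ eq ⟩
  9 * x * y  ≡⟨ *-comm-right 9 x y ⟩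
  9 * y * x  ∎
  where
  *-comm-right : ∀ a b c → a * b * c ≡ a * c * b
  *-comm-right = solve-∀

x*x*y<lhs : ∀ x y → x * x * y < lhs x y
x*x*y<lhs x y = ≤-<-trans (≤-trans x*x*y≤ (m≤m+n _ (x * y * y))) (m<m+n _ (s≤s z≤n))
  where
  x*x*y≤ : x * x * y ≤ x * x + y * y + 2 * x + 2 * y + x * x * y
  x*x*y≤ = m≤n+m (x * x * y) (x * x + y * y + 2 * x + 2 * y)

solution⇒x<9 : ∀ x y → Solution x y → x < 9
solution⇒x<9 x y eq with 9 ≤? x
... | no 9≰x = ≰⇒> 9≰x
... | yes 9≤x = contradiction (≤-<-trans (*-monoˡ-≤ y (*-monoˡ-≤ x 9≤x)) (x*x*y<lhs x y)) (<-irrefl (sym eq))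

solution⇒y<9 : ∀ x y → Solution x y → y < 9
solution⇒y<9 x y eq = solution⇒x<9 y x (solution-sym x y eq)

small-solution⇒listed : ∀ {x y} → x < 9 → y < 9 → Solution x y → Listed x y
small-solution⇒listed x<9 = from-yes (allUpTo? (λ x → allUpTo? (λ y → solution? x y →-dec listed? x y) 9) 9) x<9

listed⇒solution : ∀ {x y} → Listed x y → Solution x y
listed⇒solution (inj₁ (refl , refl)) = refl
listed⇒solution (inj₂ (inj₁ (refl , refl))) = refl
listed⇒solution (inj₂ (inj₂ (inj₁ (refl , refl)))) = refl
listed⇒solution (inj₂ (inj₂ (inj₂ (inj₁ (refl , refl))))) = refl
listed⇒solution (inj₂ (inj₂ (inj₂ (inj₂ (refl , refl))))) = refl

proposition5p6 : (x y : ℕ) → 1 ≤ x → 1 ≤ y →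
    ((x * x + y * y + 2 * x + 2 * y + x * x * y + x * y * y + 1 ≡ 9 * x * y)
      ⇔ ((x ≡ 1 × y ≡ 1) ⊎ (x ≡ 1 × y ≡ 2) ⊎ (x ≡ 2 × y ≡ 1) ⊎ (x ≡ 2 × y ≡ 3) ⊎ (x ≡ 3 × y ≡ 2)))
proposition5p6 x y _ _ = mk⇔
  (λ eq → small-solution⇒listed (solution⇒x<9 x y eq) (solution⇒y<9 x y eq) eq)
  listed⇒solution
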